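{- Let $\mathbb{F}$ be an n-frame (resp. a c-frame) and $\varphi\vdash\psi$ an $\mathcal{L}_\nabla$-sequent (resp. an $\mathcal{L}_>$-sequent). Then $\mathbb{F}\Vdash\varphi\vdash\psi$ if and only if $\mathbb{F}^\star\Vdash\tau(\varphi\vdash\psi)$.
   Context: Fix a set $\mathsf{Prop}$ of propositional variables. $\mathcal{L}_\nabla$: $\varphi::=p\mid\neg\varphi\mid\varphi\wedge\varphi\mid\nabla\varphi$; $\mathcal{L}_>$: $\varphi::=p\mid\neg\varphi\mid\varphi\wedge\varphi\mid\varphi>\varphi$. An n-frame is $(W,\nu)$ with $W$ nonempty and $\nu:W\to\mathcal{P}(\mathcal{P}(W))$ with each $\nu(w)$ upward closed; a c-frame is $(W,f)$ with $f:W\times\mathcal{P}(W)\to\mathcal{P}(W)$. Given a valuation $V:\mathsf{Prop}\to\mathcal{P}(W)$, formulas are interpreted by $V(\neg\varphi)=W\setminus V(\varphi)$, $V(\varphi\wedge\psi)=V(\varphi)\cap V(\psi)$, $V(\nabla\varphi)=\{w\mid V(\varphi)\in\nu(w)\}$, $V(\varphi>\psi)=\{w\mid f(w,V(\varphi))\subseteq V(\psi)\}$; $\mathbb{F}\Vdash\varphi\vdash\psi$ means $V(\varphi)\subseteq V(\psi)$ for every valuation $V$. Two-sorted frames: for an n-frame, $\mathbb{F}^\star=(W,\mathcal{P}(W),R_\ni,R_{\not\ni},R_\nu,R_{\nu^c})$ with $ZR_\ni x$ iff $x\in Z$, $ZR_{\not\ni}x$ iff $x\notin Z$, $xR_\nu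 Z$ iff $Z\in\nu(x)$, $xR_{\nu^c}Z$ iff $Z\notin\nu(x)$; for a c-frame, $\mathbb{F}^\star=(W,\mathcal{P}(W),R_\ni,R_{\not\ni},T_f)$ with $T_f(x,Z,x')$ iff $x'\in f(x,Z)$. Multi-type formulas have two sorts: sort $\mathsf{S}$ (interpreted as subsets of $W$) built from $p$, $\neg$, $\wedge$, $\langle\nu\rangle\alpha$, $[\nu^c]\alpha$, $\alpha\rhd A$, and sort $\mathsf{N}$ (interpreted as subsets of $\mathcal{P}(W)$) built from $\cap$, $[\ni]A$, $\langle\not\ni\rangle A$, $[\not\ni\rangle A$. Given $V:\mathsf{Prop}\to\mathcal{P}(W)$, Boolean connectives are interpreted set-theoretically in the relevant sort and: $V(\langle\nu\rangle\alpha)=\{x\mid\exists Z(xR_\nu Z\ \&\ Z\in V(\alpha))\}$; $V([\nu^c]\alpha)=\{x\mid\forall Z(xR_{\nu^c}Z\Rightarrow Z\in V(\alpha))\}$; $V([\ni]A)=\{Z\mid\forall x(ZR_\ni x\Rightarrow x\in V(A))\}$; $V(\langle\not\ni\rangle A)=\{Z\mid\exists x(ZR_{\not\ni}x\ \&\ x\in V(A))\}$; $V([\not\ni\rangle A)=\{Z\mid\forall x(ZR_{\not\ni}x\Rightarrow x\notin V(A))\}$; $V(\alpha\rhd A)=\{x\mid\forall Z\forall x'((T_f(x,Z,x')\ \&\ Z\in V(\alpha))\Rightarrow x'\in V(A))\}$. A sequent $A\vdash B$ of $\mathsf{S}$-formulas is valid on $\mathbb{F}^\star$ if $V(A)\subseteq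 V(B)$ for all $V$. Translations $\tau_1,\tau_2:\mathcal{L}_\nabla\to\mathsf{S}$: $\tau_i(p)=p$, $\tau_i(\varphi\wedge\psi)=\tau_i(\varphi)\wedge\tau_i(\psi)$, $\tau_1(\neg\varphi)=\neg\tau_2(\varphi)$, $\tau_2(\neg\varphi)=\neg\tau_1(\varphi)$, $\tau_1(\nabla\varphi)=\langle\nu\rangle[\ni]\tau_1(\varphi)$, $\tau_2(\nabla\varphi)=[\nu^c]\langle\not\ni\rangle\tau_2(\varphi)$. Translation $(\cdot)^\tau:\mathcal{L}_>\to\mathsf{S}$: $p^\tau=p$, $(\varphi\wedge\psi)^\tau=\varphi^\tau\wedge\psi^\tau$, $(\neg\varphi)^\tau=\neg\varphi^\tau$, $(\varphi>\psi)^\tau=([\ni]\varphi^\tau\cap[\not\ni\rangle\varphi^\tau)\rhd\psi^\tau$. Finally $\tau(\varphi\vdash\psi)=\tau_1(\varphi)\vdash\tau_2(\psi)$ for $\mathcal{L}_\nabla$-sequents and $\tau(\varphi\vdash\psi)=\varphi^\tau\vdash\psi^\tau$ for $\mathcal{L}_>$-sequents. -}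

module Defs where

open import Level using (Level; 0ℓ) renaming (suc to lsuc)
open import Data.Product using (Σ; _×_; _,_)
open import Data.Empty using (⊥)
open import Relation.Nullary using (¬_)

Subset : Set → Set₁
Subset W = W → Set

_⊆_ : {W : Set} → Subset W → Subset W → Set
X ⊆ Y = ∀ x → X x → Y x

data Fml∇ (P : Set) : Set where
  var : P → Fml∇ P
  neg : Fml∇ P → Fml∇ P
  and : Fml∇ P → Fml∇ P → Fml∇ P
  nab : Fml∇ P → Fml∇ P

data Fml> (P : Set) : Set where
  var  : P → Fml> P
  neg  : Fml> P → Fml> P
  and  : Fml> P → Fml> P → Fml> P
  cond : Fml> P → Fml> P → Fml> P

record NFrame : Set₂ where
  field
    W       : Set
    point   : W
    ν       : W → Subset W → Set
    upward  : ∀ w (X Y : Subset W) → X ⊆ Y → ν w X → ν w Y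

-- c-frame: W nonempty, f : W × P(W) → P(W).  Since subsets are encoded
-- as predicates, f must be well defined on sets, i.e. respect
-- extensional equality of predicates.
record CFrame : Set₂ where
  field
    W      : Set
    point  : W
    f      : W → Subset W → Subset W
    f-ext  : ∀ w (X Y : Subset W) → X ⊆ Y → Y ⊆ X → f w X ⊆ f w Y

module _ {P : Set} (F : NFrame) where
  open NFrame F
  ⟦_⟧∇ : Fml∇ P → (P → Subset W) → Subset W
  ⟦ var p ⟧∇ V x = V p x
  ⟦ neg φ ⟧∇ V x = ¬ ⟦ φ ⟧∇ V x
  ⟦ and φ ψ ⟧∇ V x = ⟦ φ ⟧∇ V x × ⟦ ψ ⟧∇ V x
  ⟦ nab φ ⟧∇ V x = ν x (⟦ φ ⟧∇ V)

  ValidN : Fml∇ P → Fml∇ P → Set₁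
  ValidN φ ψ = ∀ (V : P → Subset W) → ⟦ φ ⟧∇ V ⊆ ⟦ ψ ⟧∇ V

module _ {P : Set} (F : CFrame) where
  open CFrame F
  ⟦_⟧> : Fml> P → (P → Subset W) → Subset W
  ⟦ var p ⟧> V x = V p x
  ⟦ neg φ ⟧> V x = ¬ ⟦ φ ⟧> V x
  ⟦ and φ ψ ⟧> V x = ⟦ φ ⟧> V x × ⟦ ψ ⟧> V x
  ⟦ cond φ ψ ⟧> V x = f x (⟦ φ ⟧> V) ⊆ ⟦ ψ ⟧> V

  ValidC : Fml> P → Fml> P → Set₁
  ValidC φ ψ = ∀ (V : P → Subset W) → ⟦ φ ⟧> V ⊆ ⟦ ψ ⟧> V

mutual
  data SFml (P : Set) : Set where
    var   : P → SFml P
    neg   : SFml P → SFml P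
    and   : SFml P → SFml P → SFml P
    ⟨ν⟩_  : NFml P → SFml P
    [νc]_ : NFml P → SFml P
    _▷_   : NFml P → SFml P → SFml P

  data NFml (P : Set) : Set where
    _∩_    : NFml P → NFml P → NFml P
    [∋]_   : SFml P → NFml P
    ⟨∌⟩_   : SFml P → NFml P
    [∌⟩_   : SFml P → NFml P

-- Two-sorted frame (W, P(W), R∋, R∌, Rν, Rνc, T).  R∋ and R∌ are always
-- the fixed membership / non-membership relations, so are not fields.
record TFrame : Set₂ where
  field
    W   : Set
    Rν  : W → Subset W → Set
    Rνc : W → Subset W → Set
    T   : W → Subset W → W → Set

module _ {P : Set} (F : TFrame) where
  open TFrame F
  mutual
    ⟦_⟧S : SFml P → (P → Subset W) → W → Set₁
    ⟦ var p ⟧S V x = Level.Lift _ (V p x)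
    ⟦ neg A ⟧S V x = ¬ ⟦ A ⟧S V x
    ⟦ and A B ⟧S V x = ⟦ A ⟧S V x × ⟦ B ⟧S V x
    ⟦ ⟨ν⟩ α ⟧S V x = Σ (Subset W) λ Z → Rν x Z × ⟦ α ⟧N V Z
    ⟦ [νc] α ⟧S V x = ∀ (Z : Subset W) → Rνc x Z → ⟦ α ⟧N V Z
    ⟦ α ▷ A ⟧S V x = ∀ (Z : Subset W) (x' : W) → T x Z x' → ⟦ α ⟧N V Z → ⟦ A ⟧S V x'

    ⟦_⟧N : NFml P → (P → Subset W) → Subset W → Set₁
    ⟦ α ∩ β ⟧N V Z = ⟦ α ⟧N V Z × ⟦ β ⟧N V Z
    -- Z R∋ x iff x ∈ Z ;  Z R∌ x iff x ∉ Z
    ⟦ [∋] A ⟧N V Z = ∀ (x : W) → Z x → ⟦ A ⟧S V x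
    ⟦ ⟨∌⟩ A ⟧N V Z = Σ W λ x → ¬ Z x × ⟦ A ⟧S V x
    ⟦ [∌⟩ A ⟧N V Z = ∀ (x : W) → ¬ Z x → ¬ ⟦ A ⟧S V x

  ValidT : SFml P → SFml P → Set₁
  ValidT A B = ∀ (V : P → Subset W) (x : W) → ⟦ A ⟧S V x → ⟦ B ⟧S V x

-- F* for an n-frame (no ternary relation: T is empty, unused by τ1/τ2)
nStar : NFrame → TFrame
nStar F = record
  { W = W ; Rν = λ x Z → ν x Z ; Rνc = λ x Z → ¬ ν x Z ; T = λ _ _ _ → ⊥ }
  where open NFrame F

-- F* for a c-frame (no Rν, Rνc: empty, unused by (·)^τ)
cStar : CFrame → TFrame
cStar F = record
  { W = W ; Rν = λ _ _ → ⊥ ; Rνc = λ _ _ → ⊥ ; T = λ x Z x' → f x Z x' }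
  where open CFrame F

mutual
  τ₁ : {P : Set} → Fml∇ P → SFml P
  τ₁ (var p) = var p
  τ₁ (and φ ψ) = and (τ₁ φ) (τ₁ ψ)
  τ₁ (neg φ) = neg (τ₂ φ)
  τ₁ (nab φ) = ⟨ν⟩ ([∋] τ₁ φ)

  τ₂ : {P : Set} → Fml∇ P → SFml P
  τ₂ (var p) = var p
  τ₂ (and φ ψ) = and (τ₂ φ) (τ₂ ψ)
  τ₂ (neg φ) = neg (τ₁ φ)
  τ₂ (nab φ) = [νc] (⟨∌⟩ τ₂ φ)

_^τ : {P : Set} → Fml> P → SFml P
var p ^τ = var p
and φ ψ ^τ = and (φ ^τ) (ψ ^τ)
neg φ ^τ = neg (φ ^τ)
cond φ ψ ^τ = (([∋] (φ ^τ)) ∩ ([∌⟩ (φ ^τ))) ▷ (ψ ^τ)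

-- Both translations are proved correct formula by formula: the multi-type
-- translation of φ has, at every world, the same truth value as φ itself, and
-- validity transfers immediately. The only non-trivial clauses are the modal
-- ones. In F*, ⟨ν⟩[∋]A says that some neighbourhood lies inside the extension
-- of A, which by upward closure means that the extension is a neighbourhood;
-- [νc]⟨∌⟩A says that no non-neighbourhood contains the extension, which
-- classically and by upward closure means the same. In the conditional clause,
-- [∋]A ∩ [∌⟩A holds of exactly the sets equal to the extension of A, so the
-- quantification over Z in ▷ collapses to f x ⟦φ⟧.
module Submission where

open import Defs
open import Level using (0ℓ; Lift; lift; lower) renaming (suc to lsuc)
open import Data.Product using (_×_; _,_; Σ)
open import Data.Product.Function.NonDependent.Propositional using (_×-⇔_)
open import Function.Base using (case_of_)
open import Function.Bundles using (_⇔_; mk⇔; Equivalence)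
open import Function.Related.TypeIsomorphisms using (¬-cong-⇔)
open import Relation.Nullary using (¬_)
open import Axiom.ExcludedMiddle using (ExcludedMiddle)
open import Axiom.DoubleNegationElimination using (DoubleNegationElimination; em⇒dne)

open Equivalence using (to; from)

dne-lower : DoubleNegationElimination (lsuc 0ℓ) → DoubleNegationElimination 0ℓ
dne-lower dne ¬¬a = lower (dne λ ¬lifted → ¬¬a λ a → ¬lifted (lift a))

module Classical (dne : DoubleNegationElimination 0ℓ) {W : Set} {X Y : Subset W} where

  ⊈⇒witness : ¬ (X ⊆ Y) → Σ W λ x → X x × ¬ Y x
  ⊈⇒witness X⊈Y = dne λ none → X⊈Y λ x Xx → dne λ ¬Yx → none (x , Xx , ¬Yx)

  ∁-disjoint⇒⊆ : (∀ x → ¬ Y x → ¬ X x) → X ⊆ Y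
  ∁-disjoint⇒⊆ disjoint x Xx = dne λ ¬Yx → disjoint x ¬Yx Xx

consequence-transfer : {I : Set₁} {W : Set} {φ ψ : I → Subset W} {A B : I → W → Set₁} →
  (∀ i x → A i x ⇔ φ i x) → (∀ i x → B i x ⇔ ψ i x) →
  (∀ i → φ i ⊆ ψ i) ⇔ (∀ i x → A i x → B i x)
consequence-transfer A⇔φ B⇔ψ = mk⇔
  (λ φ⊆ψ i x a → from (B⇔ψ i x) (φ⊆ψ i x (to (A⇔φ i x) a)))
  (λ A⊆B i x a → to (B⇔ψ i x) (A⊆B i x (from (A⇔φ i x) a)))

module NeighbourhoodSemantics (dne : DoubleNegationElimination 0ℓ) {P : Set} (F : NFrame) where
  open NFrame F
  open Classical dne

  ⟦_⟧ : Fml∇ P → (P → Subset W) → Subset W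
  ⟦_⟧ = ⟦_⟧∇ F

  ⟦_⟧* : SFml P → (P → Subset W) → W → Set₁
  ⟦_⟧* = ⟦_⟧S (nStar F)

  module _ {A : SFml P} {V : P → Subset W} {X : Subset W}
           (A⇔X : ∀ y → ⟦ A ⟧* V y ⇔ X y) (x : W) where

    ⟨ν⟩[∋]-correct : ⟦ ⟨ν⟩ ([∋] A) ⟧* V x ⇔ ν x X
    ⟨ν⟩[∋]-correct = mk⇔
      (λ (Z , Z∈ν , Z⊆A) → upward x Z X (λ y Zy → to (A⇔X y) (Z⊆A y Zy)) Z∈ν)
      (λ X∈ν → X , X∈ν , λ y Xy → from (A⇔X y) Xy)

    [νc]⟨∌⟩-correct : ⟦ [νc] (⟨∌⟩ A) ⟧* V x ⇔ ν x X
    [νc]⟨∌⟩-correct = mk⇔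
      (λ A⊈non-ν → dne λ X∉ν →
        case A⊈non-ν X X∉ν of λ (y , ¬Xy , Ay) → ¬Xy (to (A⇔X y) Ay))
      (λ X∈ν Z Z∉ν →
        case ⊈⇒witness (λ X⊆Z → Z∉ν (upward x X Z X⊆Z X∈ν)) of
          λ (y , Xy , ¬Zy) → y , ¬Zy , from (A⇔X y) Xy)

  mutual
    τ₁-correct : ∀ φ V x → ⟦ τ₁ φ ⟧* V x ⇔ ⟦ φ ⟧ V x
    τ₁-correct (var p)   V x = mk⇔ lower lift
    τ₁-correct (neg φ)   V x = ¬-cong-⇔ (τ₂-correct φ V x)
    τ₁-correct (and φ ψ) V x = τ₁-correct φ V x ×-⇔ τ₁-correct ψ V x
    τ₁-correct (nab φ)   V x = ⟨ν⟩[∋]-correct (τ₁-correct φ V) x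

    τ₂-correct : ∀ φ V x → ⟦ τ₂ φ ⟧* V x ⇔ ⟦ φ ⟧ V x
    τ₂-correct (var p)   V x = mk⇔ lower lift
    τ₂-correct (neg φ)   V x = ¬-cong-⇔ (τ₁-correct φ V x)
    τ₂-correct (and φ ψ) V x = τ₂-correct φ V x ×-⇔ τ₂-correct ψ V x
    τ₂-correct (nab φ)   V x = [νc]⟨∌⟩-correct (τ₂-correct φ V) x

  validity-correct : (φ ψ : Fml∇ P) → ValidN F φ ψ ⇔ ValidT (nStar F) (τ₁ φ) (τ₂ ψ)
  validity-correct φ ψ = consequence-transfer (τ₁-correct φ) (τ₂-correct ψ)

module ConditionalSemantics (dne : DoubleNegationElimination 0ℓ) {P : Set} (F : CFrame) where
  open CFrame F
  open Classical dne

  ⟦_⟧ : Fml> P → (P → Subset W) → Subset W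
  ⟦_⟧ = ⟦_⟧> F

  ⟦_⟧* : SFml P → (P → Subset W) → W → Set₁
  ⟦_⟧* = ⟦_⟧S (cStar F)

  [∋]∩[∌⟩-defines-extension : ∀ {A V} {X : Subset W} → (∀ y → ⟦ A ⟧* V y ⇔ X y) →
    ∀ Z → ⟦_⟧N (cStar F) (([∋] A) ∩ ([∌⟩ A)) V Z ⇔ (Z ⊆ X × X ⊆ Z)
  [∋]∩[∌⟩-defines-extension A⇔X Z = mk⇔
    (λ (Z⊆A , ∁Z∩A=∅) →
      (λ y Zy → to (A⇔X y) (Z⊆A y Zy)) ,
      ∁-disjoint⇒⊆ λ y ¬Zy Xy → ∁Z∩A=∅ y ¬Zy (from (A⇔X y) Xy))
    (λ (Z⊆X , X⊆Z) →
      (λ y Zy → from (A⇔X y) (Z⊆X y Zy)) ,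
      (λ y ¬Zy Ay → ¬Zy (X⊆Z y (to (A⇔X y) Ay))))

  ^τ-correct : ∀ φ V x → ⟦ φ ^τ ⟧* V x ⇔ ⟦ φ ⟧ V x
  ^τ-correct (var p)    V x = mk⇔ lower lift
  ^τ-correct (neg φ)    V x = ¬-cong-⇔ (^τ-correct φ V x)
  ^τ-correct (and φ ψ)  V x = ^τ-correct φ V x ×-⇔ ^τ-correct ψ V x
  ^τ-correct (cond φ ψ) V x = mk⇔
    (λ h x′ x′∈f → to (^τ-correct ψ V x′)
      (h (⟦ φ ⟧ V) x′ x′∈f (from (is-extension (⟦ φ ⟧ V)) ((λ _ a → a) , (λ _ a → a)))))
    (λ h Z x′ x′∈f Z-is-ext → from (^τ-correct ψ V x′)
      (let (Z⊆φ , φ⊆Z) = to (is-extension Z) Z-is-ext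
       in h x′ (f-ext x Z (⟦ φ ⟧ V) Z⊆φ φ⊆Z x′ x′∈f)))
    where
    is-extension : ∀ Z → ⟦_⟧N (cStar F) (([∋] (φ ^τ)) ∩ ([∌⟩ (φ ^τ))) V Z ⇔
                         (Z ⊆ ⟦ φ ⟧ V × ⟦ φ ⟧ V ⊆ Z)
    is-extension = [∋]∩[∌⟩-defines-extension (^τ-correct φ V)

  validity-correct : (φ ψ : Fml> P) → ValidC F φ ψ ⇔ ValidT (cStar F) (φ ^τ) (ψ ^τ)
  validity-correct φ ψ = consequence-transfer (^τ-correct φ) (^τ-correct ψ)

mainTheorem9 : ExcludedMiddle (lsuc 0ℓ) →
    ((P : Set) (F : NFrame) (φ ψ : Fml∇ P) →
    (ValidN F φ ψ ⇔ ValidT (nStar F) (τ₁ φ) (τ₂ ψ)))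
    × ((P : Set) (F : CFrame) (φ ψ : Fml> P) →
    (ValidC F φ ψ ⇔ ValidT (cStar F) (φ ^τ) (ψ ^τ)))
mainTheorem9 em =
  (λ P F → NeighbourhoodSemantics.validity-correct dne F) ,
  (λ P F → ConditionalSemantics.validity-correct dne F)
  where
  dne : DoubleNegationElimination 0ℓ
  dne = dne-lower (em⇒dne em)
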